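{- Let $n \geq 6$ be even and let $G_0=(V,E)$ be a graph on $n$ vertices. Suppose there are vertices $x,y \in V$ with $d_{G_0}(x)=d_{G_0}(y)=0$ such that $G_0 \setminus \{x,y\}$ has a Hamilton cycle. If Max is the second player, then $s(G_0,\mathcal{PM}) \geq \binom{n-2}{2}$.
   Context: $\mathcal{PM}$ is the property of admitting a perfect matching. For a graph $H$ on $n$ vertices not in $\mathcal{PM}$, the saturation game $(H,\mathcal{PM})$ is played as follows. Starting with $G=H$, two players, Mini and Max, alternately add to $G$ an edge $e \notin E(G)$ such that $G\cup\{e\}$ has no perfect matching. The game ends when no such edge exists. Max wants to maximize and Mini to minimize the final number of edges. The score $s(H,\mathcal{PM})$ is the number of edges of the final graph under optimal play. $G_0\setminus S$ denotes the graph obtained by deleting the vertex set $S$. -}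

module Defs where

open import Data.Nat using (ℕ; zero; suc; _<_; _≤_; _<ᵇ_)
open import Data.Fin using (Fin; toℕ; _≟_)
open import Data.List using (List; map; allFin)
open import Data.Nat.ListAction using (sum)
open import Data.Bool using (Bool; true; false; _∧_; _∨_; if_then_else_)
open import Data.Product using (Σ; ∃; _×_; _,_)
open import Data.Sum using (_⊎_)
open import Relation.Nullary using (¬_)
open import Relation.Nullary.Decidable using (⌊_⌋)
open import Relation.Binary.PropositionalEquality using (_≡_; _≢_)

Graph : ℕ → Set
Graph n = Fin n → Fin n → Bool

IsSimple : ∀ {n} → Graph n → Set
IsSimple {n} G = (∀ (u v : Fin n) → G u v ≡ G v u) × (∀ (u : Fin n) → G u u ≡ false)

addEdge : ∀ {n} → Graph n → Fin n → Fin n → Graph n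
addEdge G u v a b = G a b ∨ (⌊ a ≟ u ⌋ ∧ ⌊ b ≟ v ⌋) ∨ (⌊ a ≟ v ⌋ ∧ ⌊ b ≟ u ⌋)

edgeCount : ∀ {n} → Graph n → ℕ
edgeCount {n} G =
  sum (map (λ u → sum (map (λ v → if (toℕ u <ᵇ toℕ v) ∧ G u v then 1 else 0)
                           (allFin n)))
           (allFin n))

-- A perfect matching: a fixed-point-free involution m with every v adjacent to m v
-- (i.e. the set of edges {v, m v} is a set of disjoint edges covering V).
HasPM : ∀ {n} → Graph n → Set
HasPM {n} G = Σ (Fin n → Fin n) λ m →
  (∀ v → m (m v) ≡ v) × (∀ v → m v ≢ v) × (∀ v → G v (m v) ≡ true)

Isolated : ∀ {n} → Graph n → Fin n → Set
Isolated G x = ∀ v → G x v ≡ false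

Legal : ∀ {n} → Graph n → Fin n → Fin n → Set
Legal G u v = (toℕ u < toℕ v) × (G u v ≡ false) × ¬ HasPM (addEdge G u v)

data Player : Set where
  mini max : Player

-- MaxForces k p G : in the game (G, PM) with player p to move,
-- Max has a strategy ensuring that the final graph has at least k edges
-- whatever Mini does.  (Equivalently: the minimax score is ≥ k.)
data MaxForces {n : ℕ} (k : ℕ) : Player → Graph n → Set where
  done     : ∀ {p G} → (∀ u v → ¬ Legal G u v) → k ≤ edgeCount G →
             MaxForces k p G
  miniMove : ∀ {G} → (∃ λ u → ∃ λ v → Legal G u v) →
             (∀ u v → Legal G u v → MaxForces k max (addEdge G u v)) →
             MaxForces k mini G
  maxMove  : ∀ {G} u v → Legal G u v → MaxForces k mini (addEdge G u v) →
             MaxForces k max G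

CyclicNext : ∀ {m} → Fin m → Fin m → Set
CyclicNext {m} i j = (suc (toℕ i) ≡ toℕ j) ⊎ ((suc (toℕ i) ≡ m) × (toℕ j ≡ 0))

HamCycleWithout : ∀ {n} → Graph n → Fin n → Fin n → (m : ℕ) → Set
HamCycleWithout {n} G x y m = Σ (Fin m → Fin n) λ c →
  (∀ i j → c i ≡ c j → i ≡ j) ×
  (∀ i → (c i ≢ x) × (c i ≢ y)) ×
  (∀ i j → CyclicNext i j → G (c i) (c j) ≡ true)

module Submission where

-- Write V′ = V ∖ {x, y} and C for the Hamilton cycle on V′, whose length n − 2 is even. Pairing x
-- with y and then consecutive vertices of C gives a perfect matching, so xy is never playable; more
-- generally, if y ∼ C₀ and x ∼ Cⱼ with j odd, then y C₀, x Cⱼ and consecutive pairs along the two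
-- arcs of C between C₀ and Cⱼ form a perfect matching. Max keeps x and y isolated, answering inner
-- moves by inner moves, until Mini plays an edge y w with w ∈ V′ (or x w). Max then joins y to the
-- successor of w on C: now every edge at x would complete a perfect matching, x stays isolated for
-- the rest of the game, and the game cannot end before all pairs avoiding x are edges. If instead
-- V′ becomes complete first, Max plays y C₀, and Mini's reply either kills x in the same way or is
-- x C₀, after which no legal move is left. Either way V′ ends up complete, which is (n − 2 choose 2)
-- edges.

open import Defs
open import Data.Bool using (Bool; true; false; _∧_; _∨_; not; if_then_else_)
import Data.Bool.Properties as Boolₚ
open import Data.Bool.Properties
  using (∨-comm; ∧-comm; ∨-zeroʳ; ∧-conicalˡ; ∧-conicalʳ; ∧-identityʳ; ¬-not)
open import Data.Empty using (⊥; ⊥-elim)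
open import Data.Fin as Fin using (Fin; toℕ; _≟_; punchOut)
import Data.Fin.Properties as Finₚ
open import Data.List using (map; allFin)
open import Data.List.Properties using (map-tabulate)
open import Data.Nat as ℕ using (ℕ; zero; suc; _+_; _*_; _∸_; _≤_; _<_; z≤n; s≤s; NonZero)
open import Data.Nat.Combinatorics using (_C_; nC1≡n; nCk+nC[k+1]≡[n+1]C[k+1])
open import Data.Nat.Divisibility using (_∣_; divides; ∣m+n∣m⇒∣n; ∣⇒≤)
open import Data.Nat.DivMod
  using (_%_; _mod_; n%n≡0; m%n<n; %-distribˡ-+; m%n%n≡m%n; [m+n]%n≡m%n; m<n⇒m%n≡m)
open import Data.Nat.ListAction using (sum)
open import Data.Nat.Properties
  using ( +-assoc; +-comm; +-identityʳ; +-suc; +-mono-≤; +-mono-<-≤; +-mono-≤-<; suc-injective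
        ; ≤-refl; ≤-reflexive; ≤-trans; <-trans; <-≤-trans; <-irrefl; <-cmp; <⇒≤; ≤-pred
        ; n<1+n; n≤1+n; m≤n+m; m+n≤o⇒m≤o; m≤n⇒∃[o]m+o≡n; m+[n∸m]≡n; m∸n+n≡m; m≤n⇒m<n∨m≡n
        ; module ≤-Reasoning)
open import Data.Product using (Σ; ∃-syntax; _×_; _,_; proj₁; proj₂; swap)
open import Data.Sum using (_⊎_; inj₁; inj₂; [_,_]′)
open import Data.Unit using (⊤; tt)
open import Function using (_∘_)
open import Relation.Binary.Definitions using (tri<; tri≈; tri>)
open import Relation.Binary.PropositionalEquality
open import Relation.Nullary using (¬_; Dec; yes; no; contradiction; ¬?; _×-dec_)
open import Relation.Nullary.Decidable using (⌊_⌋)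

private
  variable
    n N : ℕ
    G H : Graph n
    a b d u v w x y z : Fin n

_⊆_ : Graph n → Graph n → Set
G ⊆ H = ∀ a b → G a b ≡ true → H a b ≡ true

_≐_ : Graph n → Graph n → Set
G ≐ H = ∀ a b → G a b ≡ H a b

≐-sym : G ≐ H → H ≐ G
≐-sym G≐H a b = sym (G≐H a b)

≐⇒⊆ : G ≐ H → G ⊆ H
≐⇒⊆ G≐H a b e = trans (sym (G≐H a b)) e

Symmetric : Graph n → Set
Symmetric G = ∀ a b → G a b ≡ G b a

SamePair : Fin n → Fin n → Fin n → Fin n → Set
SamePair a b u v = (a ≡ u × b ≡ v) ⊎ (a ≡ v × b ≡ u)

true≢false : true ≢ false
true≢false ()

∨-true : ∀ p {q} → p ∨ q ≡ true → p ≡ true ⊎ q ≡ true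
∨-true true  _ = inj₁ refl
∨-true false e = inj₂ e

∨-trueʳ : ∀ p {q} → q ≡ true → p ∨ q ≡ true
∨-trueʳ p refl = ∨-zeroʳ p

≟-sound : ⌊ a ≟ b ⌋ ≡ true → a ≡ b
≟-sound {a = a} {b} e with a ≟ b
... | yes a≡b = a≡b

⊆-addEdge : ∀ (G : Graph n) u v → G ⊆ addEdge G u v
⊆-addEdge G u v a b e rewrite e = refl

addEdge-new : ∀ (G : Graph n) u v → addEdge G u v u v ≡ true
addEdge-new G u v with u ≟ u | v ≟ v
... | yes _  | yes _  = ∨-zeroʳ (G u v)
... | no u≢u | _      = ⊥-elim (u≢u refl)
... | _      | no v≢v = ⊥-elim (v≢v refl)

addEdge-comm : addEdge G u v ≐ addEdge G v u
addEdge-comm {G = G} {u} {v} a b = cong (G a b ∨_) (∨-comm (⌊ a ≟ u ⌋ ∧ ⌊ b ≟ v ⌋) _)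

addEdge-sym : Symmetric G → Symmetric (addEdge G u v)
addEdge-sym {u = u} {v} sym-G a b =
  cong₂ _∨_ (sym-G a b)
    (trans (∨-comm (⌊ a ≟ u ⌋ ∧ ⌊ b ≟ v ⌋) _)
      (cong₂ _∨_ (∧-comm ⌊ a ≟ v ⌋ _) (∧-comm ⌊ a ≟ u ⌋ _)))

addEdge-inv : addEdge G u v a b ≡ true → G a b ≡ true ⊎ SamePair a b u v
addEdge-inv {G = G} {a = a} {b} e with ∨-true (G a b) e
... | inj₁ old = inj₁ old
... | inj₂ new with ∨-true _ new
...   | inj₁ e′ = inj₂ (inj₁ (≟-sound (∧-conicalˡ _ _ e′) , ≟-sound (∧-conicalʳ _ _ e′)))
...   | inj₂ e′ = inj₂ (inj₂ (≟-sound (∧-conicalˡ _ _ e′) , ≟-sound (∧-conicalʳ _ _ e′)))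

addEdge-mono : G ⊆ H → addEdge G u v ⊆ addEdge H u v
addEdge-mono {G = G} {H} {u} {v} G⊆H a b e with ∨-true (G a b) e
... | inj₁ old = ⊆-addEdge H u v a b (G⊆H a b old)
... | inj₂ new = ∨-trueʳ (H a b) new

addEdge-cong : G ≐ H → addEdge G u v ≐ addEdge H u v
addEdge-cong G≐H a b = cong (_∨ _) (G≐H a b)

addEdge-samePair : SamePair u v a b → addEdge G u v ≐ addEdge G a b
addEdge-samePair (inj₁ (refl , refl)) _ _ = refl
addEdge-samePair {G = G} (inj₂ (refl , refl)) = addEdge-comm {G = G}

addEdge-isolated : Isolated G z → u ≢ z → v ≢ z → Isolated (addEdge G u v) z
addEdge-isolated {G = G} {z} {u} {v} iso u≢z v≢z b with addEdge G u v z b in e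
... | false = refl
... | true with addEdge-inv {G = G} {u} {v} e
...   | inj₁ old              = ⊥-elim (true≢false (trans (sym old) (iso b)))
...   | inj₂ (inj₁ (z≡u , _)) = ⊥-elim (u≢z (sym z≡u))
...   | inj₂ (inj₂ (z≡v , _)) = ⊥-elim (v≢z (sym z≡v))

only-neighbour : Isolated G y → w ≢ y → addEdge G y w y d ≡ true → d ≡ w
only-neighbour {G = G} {y} {w} {d} iso w≢y e with addEdge-inv {G = G} {y} {w} e
... | inj₁ old              = ⊥-elim (true≢false (trans (sym old) (iso d)))
... | inj₂ (inj₁ (_ , d≡w)) = d≡w
... | inj₂ (inj₂ (y≡w , _)) = ⊥-elim (w≢y (sym y≡w))

≢-by-edge : G u a ≡ true → G u w ≡ false → a ≢ w
≢-by-edge ua∈G uw∉G refl = true≢false (trans (sym ua∈G) uw∉G)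

samePair-nonEdge : Symmetric G → SamePair u v a b → G u v ≡ false → G a b ≡ false
samePair-nonEdge sym-G (inj₁ (refl , refl)) uv∉G = uv∉G
samePair-nonEdge sym-G (inj₂ (refl , refl)) uv∉G = trans (sym-G _ _) uv∉G

HasPM-mono : G ⊆ H → HasPM G → HasPM H
HasPM-mono G⊆H (m , inv , fix , adj) = m , inv , fix , λ v → G⊆H v (m v) (adj v)

isolated⇒¬HasPM : Isolated G z → ¬ HasPM G
isolated⇒¬HasPM {z = z} iso (m , _ , _ , adj) = true≢false (trans (sym (adj z)) (iso (m z)))

samePair-HasPM : SamePair u v a b → HasPM (addEdge G a b) → HasPM (addEdge G u v)
samePair-HasPM {G = G} same = HasPM-mono (≐⇒⊆ (≐-sym (addEdge-samePair {G = G} same)))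

record Listing {n} (P : Fin n → Set) (N : ℕ) (at : ℕ → Fin n) : Set where
  field
    injective  : ∀ {i j} → i < N → j < N → at i ≡ at j → i ≡ j
    member     : ∀ {i} → i < N → P (at i)
    surjective : ∀ {v} → P v → ∃[ i ] i < N × at i ≡ v

record IndexPermutation (N : ℕ) : Set where
  field
    to from  : ℕ → ℕ
    to-<     : ∀ {i} → i < N → to i < N
    from-<   : ∀ {i} → i < N → from i < N
    from-to  : ∀ {i} → i < N → from (to i) ≡ i
    to-from  : ∀ {i} → i < N → to (from i) ≡ i

permute : ∀ {P : Fin n → Set} {at} (π : IndexPermutation N) →
  Listing P N at → Listing P N (at ∘ IndexPermutation.to π)
permute {at = at} π L = record
  { injective  = λ i<N j<N eq →
      trans (sym (from-to i<N)) (trans (cong from (injective (to-< i<N) (to-< j<N) eq)) (from-to j<N))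
  ; member     = member ∘ to-<
  ; surjective = λ Pv → let i , i<N , eq = surjective Pv in
      from i , from-< i<N , trans (cong at (to-from i<N)) eq
  }
  where open IndexPermutation π; open Listing L

swapIndex : ℕ → ℕ → ℕ → ℕ
swapIndex i j k with k ℕ.≟ i | k ℕ.≟ j
... | yes _ | _     = j
... | no _  | yes _ = i
... | no _  | no _  = k

swapIndex-i : ∀ i j → swapIndex i j i ≡ j
swapIndex-i i j with i ℕ.≟ i
... | yes _   = refl
... | no i≢i = ⊥-elim (i≢i refl)

swapIndex-j : ∀ i j → swapIndex i j j ≡ i
swapIndex-j i j with j ℕ.≟ i | j ℕ.≟ j
... | yes j≡i | _      = j≡i
... | no _    | yes _  = refl
... | no _    | no j≢j = ⊥-elim (j≢j refl)

swapIndex-other : ∀ {i j k} → k ≢ i → k ≢ j → swapIndex i j k ≡ k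
swapIndex-other {i} {j} {k} k≢i k≢j with k ℕ.≟ i | k ℕ.≟ j
... | yes k≡i | _       = ⊥-elim (k≢i k≡i)
... | no _    | yes k≡j = ⊥-elim (k≢j k≡j)
... | no _    | no _    = refl

swapIndex-involutive : ∀ i j k → swapIndex i j (swapIndex i j k) ≡ k
swapIndex-involutive i j k with k ℕ.≟ i | k ℕ.≟ j
... | yes refl | _        = swapIndex-j k j
... | no _     | yes refl = swapIndex-i i k
... | no k≢i   | no k≢j   = swapIndex-other k≢i k≢j

swapIndex-< : ∀ {i j k} → i < N → j < N → k < N → swapIndex i j k < N
swapIndex-< {i = i} {j} {k} i<N j<N k<N with k ℕ.≟ i | k ℕ.≟ j
... | yes _ | _     = j<N
... | no _  | yes _ = i<N
... | no _  | no _  = k<N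

transposition : ∀ {i j} → i < N → j < N → IndexPermutation N
transposition {i = i} {j} i<N j<N = record
  { to      = swapIndex i j
  ; from    = swapIndex i j
  ; to-<    = swapIndex-< i<N j<N
  ; from-<  = swapIndex-< i<N j<N
  ; from-to = λ {k} _ → swapIndex-involutive i j k
  ; to-from = λ {k} _ → swapIndex-involutive i j k
  }

module _ {N : ℕ} .{{_ : NonZero N}} where

  [m+k%N]%N≡[m+k]%N : ∀ m k → (m + k % N) % N ≡ (m + k) % N
  [m+k%N]%N≡[m+k]%N m k = begin
    (m + k % N) % N            ≡⟨ %-distribˡ-+ m (k % N) N ⟩
    (m % N + k % N % N) % N    ≡⟨ cong (λ t → (m % N + t) % N) (m%n%n≡m%n k N) ⟩
    (m % N + k % N) % N        ≡⟨ %-distribˡ-+ m k N ⟨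
    (m + k) % N                ∎
    where open ≡-Reasoning

  [N+i]%N≡i : ∀ {i} → i < N → (N + i) % N ≡ i
  [N+i]%N≡i {i} i<N = trans (cong (_% N) (+-comm N i)) (trans ([m+n]%n≡m%n i N) (m<n⇒m%n≡m i<N))

  rotation : ∀ {k} → k ≤ N → IndexPermutation N
  rotation {k} k≤N = record
    { to      = λ i → (k + i) % N
    ; from    = λ i → ((N ∸ k) + i) % N
    ; to-<    = λ {i} _ → m%n<n (k + i) N
    ; from-<  = λ {i} _ → m%n<n ((N ∸ k) + i) N
    ; from-to = λ {i} i<N → begin
        ((N ∸ k) + (k + i) % N) % N   ≡⟨ [m+k%N]%N≡[m+k]%N (N ∸ k) (k + i) ⟩
        ((N ∸ k) + (k + i)) % N       ≡⟨ cong (_% N) (+-assoc (N ∸ k) k i) ⟨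
        ((N ∸ k) + k + i) % N         ≡⟨ cong (λ t → (t + i) % N) (m∸n+n≡m k≤N) ⟩
        (N + i) % N                   ≡⟨ [N+i]%N≡i i<N ⟩
        i                             ∎
    ; to-from = λ {i} i<N → begin
        (k + ((N ∸ k) + i) % N) % N   ≡⟨ [m+k%N]%N≡[m+k]%N k ((N ∸ k) + i) ⟩
        (k + ((N ∸ k) + i)) % N       ≡⟨ cong (_% N) (+-assoc k (N ∸ k) i) ⟨
        (k + (N ∸ k) + i) % N         ≡⟨ cong (λ t → (t + i) % N) (m+[n∸m]≡n k≤N) ⟩
        (N + i) % N                   ≡⟨ [N+i]%N≡i i<N ⟩
        i                             ∎
    }
    where open ≡-Reasoning

insert : ℕ → Fin n → (ℕ → Fin n) → ℕ → Fin n
insert zero    v f zero    = v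
insert zero    v f (suc i) = f i
insert (suc p) v f zero    = f zero
insert (suc p) v f (suc i) = insert p v (f ∘ suc) i

insert-< : ∀ {p i} (f : ℕ → Fin n) → i < p → insert p v f i ≡ f i
insert-< {p = suc p} {zero}  f _         = refl
insert-< {p = suc p} {suc i} f (s≤s i<p) = insert-< (f ∘ suc) i<p

insert-≡ : ∀ p (f : ℕ → Fin n) → insert p v f p ≡ v
insert-≡ zero    f = refl
insert-≡ (suc p) f = insert-≡ p (f ∘ suc)

insert-≥ : ∀ {p i} (f : ℕ → Fin n) → p ≤ i → insert p v f (suc i) ≡ f i
insert-≥ {p = zero}            f _         = refl
insert-≥ {p = suc p} {suc i} f (s≤s p≤i) = insert-≥ (f ∘ suc) p≤i

data InsertView (p : ℕ) : ℕ → Set where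
  before : ∀ {i} → i < p → InsertView p i
  here   : InsertView p p
  after  : ∀ {i} → p ≤ i → InsertView p (suc i)

insertView : ∀ p i → InsertView p i
insertView p i with <-cmp i p
... | tri< i<p _ _ = before i<p
... | tri≈ _ refl _ = here
insertView p (suc i) | tri> _ _ (s≤s p≤i) = after p≤i

insert-listing : ∀ {P : Fin n → Set} {f p} → Listing P N f → ¬ P v → p ≤ N →
  Listing (λ w → w ≡ v ⊎ P w) (suc N) (insert p v f)
insert-listing {n} {N} {v} {P} {f} {p} L ¬Pv p≤N = record
  { injective  = inj
  ; member     = mem
  ; surjective = λ where
      (inj₁ refl) → p , s≤s p≤N , insert-≡ p f
      (inj₂ Pw)   → let i , i<N , eq = surjective Pw in position i<N eq
  }
  where
  open Listing L

  v≢f : ∀ {k} → k < N → v ≢ f k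
  v≢f k<N v≡fk = ¬Pv (subst P (sym v≡fk) (member k<N))

  mem : ∀ {i} → i < suc N → insert p v f i ≡ v ⊎ P (insert p v f i)
  mem {i} i<1+N with insertView p i
  ... | before i<p = inj₂ (subst P (sym (insert-< f i<p)) (member (<-≤-trans i<p p≤N)))
  ... | here       = inj₁ (insert-≡ p f)
  ... | after p≤i  = inj₂ (subst P (sym (insert-≥ f p≤i)) (member (≤-pred i<1+N)))

  inj : ∀ {i j} → i < suc N → j < suc N → insert p v f i ≡ insert p v f j → i ≡ j
  inj {i} {j} i<1+N j<1+N eq with insertView p i | insertView p j
  ... | here | here = refl
  ... | here | before j<p =
    ⊥-elim (v≢f (<-≤-trans j<p p≤N) (trans (sym (insert-≡ p f)) (trans eq (insert-< f j<p))))
  ... | here | after p≤j =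
    ⊥-elim (v≢f (≤-pred j<1+N) (trans (sym (insert-≡ p f)) (trans eq (insert-≥ f p≤j))))
  ... | before i<p | here =
    ⊥-elim (v≢f (<-≤-trans i<p p≤N) (trans (sym (insert-≡ p f)) (trans (sym eq) (insert-< f i<p))))
  ... | after p≤i | here =
    ⊥-elim (v≢f (≤-pred i<1+N) (trans (sym (insert-≡ p f)) (trans (sym eq) (insert-≥ f p≤i))))
  ... | before i<p | before j<p =
    injective (<-≤-trans i<p p≤N) (<-≤-trans j<p p≤N)
      (trans (sym (insert-< f i<p)) (trans eq (insert-< f j<p)))
  ... | after p≤i | after p≤j =
    cong suc (injective (≤-pred i<1+N) (≤-pred j<1+N)
      (trans (sym (insert-≥ f p≤i)) (trans eq (insert-≥ f p≤j))))
  ... | before i<p | after {j′} p≤j =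
    ⊥-elim (<-irrefl refl (<-≤-trans i<p (subst (p ≤_) (sym i≡j) p≤j)))
    where
    i≡j : i ≡ j′
    i≡j = injective (<-≤-trans i<p p≤N) (≤-pred j<1+N)
            (trans (sym (insert-< f i<p)) (trans eq (insert-≥ f p≤j)))
  ... | after {i′} p≤i | before j<p =
    ⊥-elim (<-irrefl refl (<-≤-trans j<p (subst (p ≤_) i≡j p≤i)))
    where
    i≡j : i′ ≡ j
    i≡j = injective (≤-pred i<1+N) (<-≤-trans j<p p≤N)
            (trans (sym (insert-≥ f p≤i)) (trans eq (insert-< f j<p)))

  position : ∀ {w i} → i < N → f i ≡ w → ∃[ j ] j < suc N × insert p v f j ≡ w
  position {i = i} i<N eq with <-cmp i p
  ... | tri< i<p _ _ = i , ≤-trans i<N (n≤1+n N) , trans (insert-< f i<p) eq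
  ... | tri≈ _ i≡p _ = suc i , s≤s i<N , trans (insert-≥ f (≤-reflexive (sym i≡p))) eq
  ... | tri> _ _ p<i = suc i , s≤s i<N , trans (insert-≥ f (<⇒≤ p<i)) eq

Listing-map : ∀ {P Q : Fin n → Set} {f} → (∀ {v} → P v → Q v) → (∀ {v} → Q v → P v) →
  Listing P N f → Listing Q N f
Listing-map P⇒Q Q⇒P L = record
  { injective = injective ; member = P⇒Q ∘ member ; surjective = surjective ∘ Q⇒P }
  where open Listing L

-- Hamilton cycles of V ∖ {x, y}

Inner : Fin n → Fin n → Fin n → Set
Inner x y v = v ≢ x × v ≢ y

InnerComplete : Graph n → Fin n → Fin n → Set
InnerComplete G x y = ∀ {a b} → Inner x y a → Inner x y b → a ≢ b → G a b ≡ true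

InnerComplete-swap : InnerComplete G x y → InnerComplete G y x
InnerComplete-swap complete (a≢y , a≢x) (b≢y , b≢x) = complete (a≢x , a≢y) (b≢x , b≢y)

InnerComplete-mono : G ⊆ H → InnerComplete G x y → InnerComplete H x y
InnerComplete-mono G⊆H complete inner-a inner-b a≢b = G⊆H _ _ (complete inner-a inner-b a≢b)

InnerComplete-addEdge : ∀ u v → InnerComplete G x y → InnerComplete (addEdge G u v) x y
InnerComplete-addEdge {G = G} u v = InnerComplete-mono (⊆-addEdge G u v)

record Cycle (G : Graph n) (x y : Fin n) (N : ℕ) .{{_ : NonZero N}} : Set where
  field
    at       : ℕ → Fin n
    listing  : Listing (Inner x y) N at
    adjacent : ∀ {i} → i < N → G (at i) (at (suc i % N)) ≡ true
  open Listing listing public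

module _ {N : ℕ} .{{_ : NonZero N}} where

  Cycle-mono : G ⊆ H → Cycle G x y N → Cycle H x y N
  Cycle-mono G⊆H cyc = record
    { at = at ; listing = listing ; adjacent = λ i<N → G⊆H _ _ (adjacent i<N) }
    where open Cycle cyc

  Cycle-addEdge : ∀ u v → Cycle G x y N → Cycle (addEdge G u v) x y N
  Cycle-addEdge {G = G} u v = Cycle-mono (⊆-addEdge G u v)

  Cycle-swap : Cycle G x y N → Cycle G y x N
  Cycle-swap cyc = record
    { at = at
    ; listing = Listing-map (λ (≢x , ≢y) → ≢y , ≢x) (λ (≢y , ≢x) → ≢x , ≢y) listing
    ; adjacent = adjacent
    }
    where open Cycle cyc

  Cycle-rotate : ∀ {k} → k ≤ N → Cycle G x y N → Cycle G x y N
  Cycle-rotate {G = G} {k = k} k≤N cyc = record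
    { at = λ i → at ((k + i) % N)
    ; listing = permute (rotation k≤N) listing
    ; adjacent = λ {i} _ → subst (λ j → G (at ((k + i) % N)) (at j) ≡ true)
        (next-rotated i) (adjacent (m%n<n (k + i) N))
    }
    where
    open Cycle cyc
    next-rotated : ∀ i → suc ((k + i) % N) % N ≡ (k + suc i % N) % N
    next-rotated i = begin
      (1 + (k + i) % N) % N   ≡⟨ [m+k%N]%N≡[m+k]%N 1 (k + i) ⟩
      suc (k + i) % N         ≡⟨ cong (_% N) (+-suc k i) ⟨
      (k + suc i) % N         ≡⟨ [m+k%N]%N≡[m+k]%N k (suc i) ⟨
      (k + suc i % N) % N     ∎
      where open ≡-Reasoning

  i≢[1+i]%N : ∀ {i} → 1 < N → i < N → i ≢ suc i % N
  i≢[1+i]%N {i} 1<N i<N with m≤n⇒m<n∨m≡n i<N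
  ... | inj₁ 1+i<N = λ i≡ → <-irrefl (trans i≡ (m<n⇒m%n≡m 1+i<N)) (n<1+n i)
  ... | inj₂ refl  = λ i≡ → <-irrefl (cong suc (sym (trans i≡ (n%n≡0 (suc i))))) 1<N

  InnerComplete⇒Cycle : ∀ {f} → InnerComplete G x y → 1 < N → Listing (Inner x y) N f →
    Cycle G x y N
  InnerComplete⇒Cycle {f = f} complete 1<N L = record
    { at = f
    ; listing = L
    ; adjacent = λ {i} i<N → complete (member i<N) (member (m%n<n (suc i) N))
        (i≢[1+i]%N 1<N i<N ∘ injective i<N (m%n<n (suc i) N))
    }
    where open Listing L

  cycle-starting-with : InnerComplete G x y → 1 < N → Cycle G x y N →
    Inner x y a → Inner x y b → a ≢ b →
    Σ (Cycle G x y N) λ cyc → Cycle.at cyc 0 ≡ a × Cycle.at cyc 1 ≡ b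
  cycle-starting-with {a = a} {b} complete 1<N cyc inner-a inner-b a≢b
    with i , i<N , at-i≡a ← Cycle.surjective cyc inner-a
    with L₁ ← permute (transposition (<-trans (s≤s z≤n) 1<N) i<N) (Cycle.listing cyc)
    with j , j<N , at₁-j≡b ← Listing.surjective L₁ inner-b
    = InnerComplete⇒Cycle complete 1<N (permute (transposition 1<N j<N) L₁) , a-first , b-second
    where
    open Cycle cyc
    at₁-0≡a : at (swapIndex 0 i 0) ≡ a
    at₁-0≡a = trans (cong at (swapIndex-i 0 i)) at-i≡a
    0≢j : 0 ≢ j
    0≢j 0≡j = a≢b (trans (sym at₁-0≡a) (trans (cong (at ∘ swapIndex 0 i) 0≡j) at₁-j≡b))
    a-first : at (swapIndex 0 i (swapIndex 1 j 0)) ≡ a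
    a-first = trans (cong (at ∘ swapIndex 0 i) (swapIndex-other {1} {j} (λ ()) 0≢j)) at₁-0≡a
    b-second : at (swapIndex 0 i (swapIndex 1 j 1)) ≡ b
    b-second = trans (cong (at ∘ swapIndex 0 i) (swapIndex-i 1 j)) at₁-j≡b

-- A missed v would give m + 1 distinct vertices avoiding x and y, which punching out x and y
-- squeezes injectively into Fin m.
injective-onto-inner : ∀ {m} {x y v : Fin (suc (suc m))} (c : Fin m → Fin (suc (suc m))) → x ≢ y →
  (∀ i j → c i ≡ c j → i ≡ j) → (∀ i → Inner x y (c i)) → Inner x y v → ∃[ i ] c i ≡ v
injective-onto-inner {m} {x} {y} {v} c x≢y c-inj c-inner (v≢x , v≢y)
  with Finₚ.any? (λ i → c i ≟ v)
... | yes hit = hit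
... | no miss = contradiction (Finₚ.injective⇒≤ squeeze-injective) (<-irrefl refl)
  where
  c⁺ : Fin (suc m) → Fin (suc (suc m))
  c⁺ Fin.zero    = v
  c⁺ (Fin.suc i) = c i
  c⁺-injective : ∀ i j → c⁺ i ≡ c⁺ j → i ≡ j
  c⁺-injective Fin.zero    Fin.zero    _  = refl
  c⁺-injective Fin.zero    (Fin.suc j) eq = ⊥-elim (miss (j , sym eq))
  c⁺-injective (Fin.suc i) Fin.zero    eq = ⊥-elim (miss (i , eq))
  c⁺-injective (Fin.suc i) (Fin.suc j) eq = cong Fin.suc (c-inj i j eq)
  x≢c⁺ : ∀ k → x ≢ c⁺ k
  x≢c⁺ Fin.zero    = v≢x ∘ sym
  x≢c⁺ (Fin.suc i) = proj₁ (c-inner i) ∘ sym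
  y≢c⁺ : ∀ k → y ≢ c⁺ k
  y≢c⁺ Fin.zero    = v≢y ∘ sym
  y≢c⁺ (Fin.suc i) = proj₂ (c-inner i) ∘ sym
  y≢ : ∀ k → punchOut x≢y ≢ punchOut (x≢c⁺ k)
  y≢ k = y≢c⁺ k ∘ Finₚ.punchOut-injective x≢y (x≢c⁺ k)
  squeeze : Fin (suc m) → Fin m
  squeeze k = punchOut (y≢ k)
  squeeze-injective : ∀ {i j} → squeeze i ≡ squeeze j → i ≡ j
  squeeze-injective {i} {j} eq = c⁺-injective i j
    (Finₚ.punchOut-injective (x≢c⁺ i) (x≢c⁺ j) (Finₚ.punchOut-injective (y≢ i) (y≢ j) eq))

module _ {N : ℕ} .{{_ : NonZero N}} where

  toℕ-mod : ∀ i → toℕ (i mod N) ≡ i % N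
  toℕ-mod i = Finₚ.toℕ-fromℕ< (m%n<n i N)

  mod-cyclicNext : ∀ {i} → i < N → CyclicNext (i mod N) ((suc i % N) mod N)
  mod-cyclicNext {i} i<N with m≤n⇒m<n∨m≡n i<N
  ... | inj₁ 1+i<N = inj₁ (begin
    suc (toℕ (i mod N))   ≡⟨ cong suc (trans (toℕ-mod i) (m<n⇒m%n≡m i<N)) ⟩
    suc i                 ≡⟨ m<n⇒m%n≡m 1+i<N ⟨
    suc i % N             ≡⟨ m%n%n≡m%n (suc i) N ⟨
    suc i % N % N         ≡⟨ toℕ-mod (suc i % N) ⟨
    toℕ ((suc i % N) mod N) ∎)
    where open ≡-Reasoning
  ... | inj₂ refl = inj₂ (cong suc (trans (toℕ-mod i) (m<n⇒m%n≡m i<N)) ,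
                    trans (toℕ-mod (suc i % N)) (trans (m%n%n≡m%n (suc i) N) (n%n≡0 N)))

  HamCycle⇒Cycle : ∀ {G : Graph (suc (suc N))} {x y} → x ≢ y →
    HamCycleWithout G x y N → Cycle G x y N
  HamCycle⇒Cycle x≢y (c , c-inj , c-inner , c-adj) = record
    { at = λ i → c (i mod N)
    ; listing = record
      { injective = λ {i} {j} i<N j<N eq → begin
          i             ≡⟨ m<n⇒m%n≡m i<N ⟨
          i % N         ≡⟨ toℕ-mod i ⟨
          toℕ (i mod N) ≡⟨ cong toℕ (c-inj _ _ eq) ⟩
          toℕ (j mod N) ≡⟨ toℕ-mod j ⟩
          j % N         ≡⟨ m<n⇒m%n≡m j<N ⟩
          j             ∎
      ; member = λ _ → c-inner _
      ; surjective = λ inner-v → let k , ck≡v = injective-onto-inner c x≢y c-inj c-inner inner-v in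
          toℕ k , Finₚ.toℕ<n k , trans (cong c (toℕ-mod-toℕ k)) ck≡v
      }
    ; adjacent = λ i<N → c-adj _ _ (mod-cyclicNext i<N)
    }
    where
    open ≡-Reasoning
    toℕ-mod-toℕ : ∀ k → toℕ k mod N ≡ k
    toℕ-mod-toℕ k = Finₚ.toℕ-injective (trans (toℕ-mod (toℕ k)) (m<n⇒m%n≡m (Finₚ.toℕ<n k)))

-- Perfect matchings read off listings

Paired : Graph n → (ℕ → Fin n) → ℕ → Set
Paired G f zero          = ⊤
Paired G f (suc zero)    = ⊥
Paired G f (suc (suc N)) = G (f 0) (f 1) ≡ true × Paired G (f ∘ suc ∘ suc) N

Paired-cong : ∀ {f g : ℕ → Fin n} N → (∀ i → f i ≡ g i) → Paired G f N → Paired G g N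
Paired-cong zero          f≗g _            = tt
Paired-cong {G = G} (suc (suc N)) f≗g (e , rest) =
  subst₂ (λ a b → G a b ≡ true) (f≗g 0) (f≗g 1) e , Paired-cong N (f≗g ∘ suc ∘ suc) rest

partner : ℕ → ℕ
partner zero          = 1
partner (suc zero)    = 0
partner (suc (suc i)) = suc (suc (partner i))

partner-involutive : ∀ i → partner (partner i) ≡ i
partner-involutive zero          = refl
partner-involutive (suc zero)    = refl
partner-involutive (suc (suc i)) = cong (suc ∘ suc) (partner-involutive i)

partner-≢ : ∀ i → partner i ≢ i
partner-≢ (suc (suc i)) eq = partner-≢ i (suc-injective (suc-injective eq))

Paired-partner : Symmetric G → ∀ {f} N → Paired G f N →
  ∀ {i} → i < N → partner i < N × G (f i) (f (partner i)) ≡ true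
Paired-partner sym-G (suc (suc N)) (e , _) {zero}     _ = s≤s (s≤s z≤n) , e
Paired-partner sym-G (suc (suc N)) (e , _) {suc zero} _ = s≤s z≤n , trans (sym-G _ _) e
Paired-partner sym-G (suc (suc N)) (_ , rest) {suc (suc i)} (s≤s (s≤s i<N)) =
  let p<N , adj = Paired-partner sym-G N rest i<N in s≤s (s≤s p<N) , adj

paired-listing⇒HasPM : ∀ {n N} {G : Graph n} {P : Fin n → Set} {f} → Symmetric G →
  Listing P N f → (∀ v → P v) → Paired G f N → HasPM G
paired-listing⇒HasPM {n} {N} {G} {f = f} sym-G L everything paired =
  match , match-involutive , match-≢ , match-adjacent
  where
  open Listing L
  index : Fin n → ℕ
  index v = proj₁ (surjective (everything v))
  index<N : ∀ v → index v < N
  index<N v = proj₁ (proj₂ (surjective (everything v)))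
  f-index : ∀ v → f (index v) ≡ v
  f-index v = proj₂ (proj₂ (surjective (everything v)))
  index-f : ∀ {i} → i < N → index (f i) ≡ i
  index-f i<N = injective (index<N _) i<N (f-index _)
  match : Fin n → Fin n
  match v = f (partner (index v))
  match-involutive : ∀ v → match (match v) ≡ v
  match-involutive v = begin
    f (partner (index (f (partner (index v)))))
      ≡⟨ cong (f ∘ partner) (index-f (proj₁ (Paired-partner sym-G N paired (index<N v)))) ⟩
    f (partner (partner (index v)))   ≡⟨ cong f (partner-involutive (index v)) ⟩
    f (index v)                       ≡⟨ f-index v ⟩
    v                                 ∎
    where open ≡-Reasoning
  match-≢ : ∀ v → match v ≢ v
  match-≢ v eq = partner-≢ (index v)
    (injective (proj₁ (Paired-partner sym-G N paired (index<N v))) (index<N v) (trans eq (sym (f-index v))))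
  match-adjacent : ∀ v → G v (match v) ≡ true
  match-adjacent v = subst (λ w → G w (match v) ≡ true) (f-index v)
    (proj₂ (Paired-partner sym-G N paired (index<N v)))

insert-paired : ∀ {p q} (f : ℕ → Fin n) → Paired G f p → G v (f p) ≡ true →
  Paired G (λ i → f (suc (p + i))) q → Paired G (insert p v f) (p + suc (suc q))
insert-paired {p = zero}        f _            v∼fp suffix = v∼fp , suffix
insert-paired {p = suc (suc p)} f (e , prefix) v∼fp suffix =
  e , insert-paired (f ∘ suc ∘ suc) prefix v∼fp suffix

module _ {N : ℕ} .{{_ : NonZero N}} {G : Graph n} {x y : Fin n} where

  Cycle-paired : (cyc : Cycle G x y N) → ∀ j q → j + q * 2 ≤ N →
    Paired G (λ i → Cycle.at cyc (j + i)) (q * 2)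
  Cycle-paired cyc j zero    _ = tt
  Cycle-paired cyc j (suc q) j+2+2q≤N =
    subst₂ (λ a b → G (at a) (at b) ≡ true) (sym (+-identityʳ j)) j+1≡
      (subst (λ k → G (at j) (at k) ≡ true) (m<n⇒m%n≡m 1+j<N) (adjacent (<-trans (n<1+n j) 1+j<N))) ,
    Paired-cong (q * 2) (λ i → cong at (sym (+-suc₂ j i))) (Cycle-paired cyc (suc (suc j)) q 2+j+2q≤N)
    where
    open Cycle cyc
    +-suc₂ : ∀ a b → a + suc (suc b) ≡ suc (suc (a + b))
    +-suc₂ a b = trans (+-suc a (suc b)) (cong suc (+-suc a b))
    j+1≡ : suc j ≡ j + 1
    j+1≡ = trans (cong suc (sym (+-identityʳ j))) (sym (+-suc j 0))
    2+j+2q≤N : suc (suc j) + q * 2 ≤ N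
    2+j+2q≤N = subst (_≤ N) (+-suc₂ j (q * 2)) j+2+2q≤N
    1+j<N : suc j < N
    1+j<N = m+n≤o⇒m≤o (suc (suc j)) 2+j+2q≤N

  -- The listing y, C₀, …, C_{N−1} with x spliced in at the even position p splits into adjacent
  -- consecutive pairs: the given prefix pairs, x with the entry it displaces, then pairs along C.
  splice⇒HasPM : Symmetric G → x ≢ y → (cyc : Cycle G x y N) → 2 ∣ N → ∀ {p} → 2 ∣ p → p ≤ N →
    Paired G (insert 0 y (Cycle.at cyc)) p → G x (insert 0 y (Cycle.at cyc) p) ≡ true → HasPM G
  splice⇒HasPM sym-G x≢y cyc 2∣N {p} 2∣p p≤N prefix x∼
    with q , p+q≡N ← m≤n⇒∃[o]m+o≡n p≤N =
    paired-listing⇒HasPM sym-G L₂ everything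
      (subst (Paired G _) length (insert-paired _ prefix x∼ suffix))
    where
    open Cycle cyc
    length : p + suc (suc q) ≡ suc (suc N)
    length = trans (+-suc p (suc q)) (cong suc (trans (+-suc p q) (cong suc p+q≡N)))
    L₁ : Listing (λ w → w ≡ y ⊎ Inner x y w) (suc N) (insert 0 y at)
    L₁ = insert-listing listing (λ (_ , y≢y) → y≢y refl) z≤n
    L₂ : Listing (λ w → w ≡ x ⊎ (w ≡ y ⊎ Inner x y w)) (suc (suc N)) (insert p x (insert 0 y at))
    L₂ = insert-listing L₁ [ x≢y , (λ (x≢x , _) → x≢x refl) ]′ (≤-trans p≤N (n≤1+n N))
    everything : ∀ w → w ≡ x ⊎ (w ≡ y ⊎ Inner x y w)
    everything w with w ≟ x | w ≟ y
    ... | yes w≡x | _       = inj₁ w≡x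
    ... | no _    | yes w≡y = inj₂ (inj₁ w≡y)
    ... | no w≢x  | no w≢y  = inj₂ (inj₂ (w≢x , w≢y))
    suffix : Paired G (λ i → at (p + i)) q
    suffix with divides r refl ← ∣m+n∣m⇒∣n (subst (2 ∣_) (sym p+q≡N) 2∣N) 2∣p =
      Cycle-paired cyc p r (≤-reflexive p+q≡N)

  xy⇒HasPM : Symmetric G → x ≢ y → Cycle G x y N → 2 ∣ N → G x y ≡ true → HasPM G
  xy⇒HasPM sym-G x≢y cyc 2∣N = splice⇒HasPM sym-G x≢y cyc 2∣N (divides 0 refl) z≤n tt

  odd-gap⇒HasPM : Symmetric G → x ≢ y → (cyc : Cycle G x y N) → 2 ∣ N → G y (Cycle.at cyc 0) ≡ true →
    ∀ {j} → j < N → 2 ∣ suc j → G x (Cycle.at cyc j) ≡ true → HasPM G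
  odd-gap⇒HasPM sym-G x≢y cyc 2∣N y∼at₀ {j} j<N (divides (suc t) 1+j≡) =
    splice⇒HasPM sym-G x≢y cyc 2∣N (divides (suc t) 1+j≡) j<N
      (subst (Paired G _) (sym 1+j≡)
        (y∼at₀ , Cycle-paired cyc 1 t (≤-trans (n≤1+n _) (subst (_≤ N) 1+j≡ j<N))))

  pendants⇒HasPM : Symmetric G → x ≢ y → InnerComplete G x y → Cycle G x y N → 2 ∣ N →
    ∀ {a b} → Inner x y a → Inner x y b → a ≢ b → G y a ≡ true → G x b ≡ true → HasPM G
  pendants⇒HasPM sym-G x≢y complete cyc 2∣N inner-a inner-b a≢b y∼a x∼b
    with cyc′ , cyc′₀≡a , cyc′₁≡b ← cycle-starting-with complete (∣⇒≤ 2∣N) cyc inner-a inner-b a≢b =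
    odd-gap⇒HasPM sym-G x≢y cyc′ 2∣N (subst (λ v → G y v ≡ true) (sym cyc′₀≡a) y∼a)
      (∣⇒≤ 2∣N) (divides 1 refl) (subst (λ v → G x v ≡ true) (sym cyc′₁≡b) x∼b)

-- Vertices that can no longer be joined

Dead : Graph n → Fin n → Set
Dead G x = ∀ {w} → w ≢ x → HasPM (addEdge G x w)

Dead-mono : G ⊆ H → Dead G x → Dead H x
Dead-mono {x = x} G⊆H dead {w} w≢x = HasPM-mono (addEdge-mono {u = x} {w} G⊆H) (dead w≢x)

even-or-odd : ∀ j → 2 ∣ j ⊎ 2 ∣ suc j
even-or-odd zero    = inj₁ (divides 0 refl)
even-or-odd (suc j) with even-or-odd j
... | inj₁ (divides q j≡) = inj₂ (divides (suc q) (cong (suc ∘ suc) j≡))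
... | inj₂ 2∣1+j         = inj₁ 2∣1+j

module _ {N : ℕ} .{{_ : NonZero N}} (2∣N : 2 ∣ N) where

  even-predecessor : ∀ {j} → j < N → 2 ∣ j → ∃[ i ] i < N × 2 ∣ suc i × suc i % N ≡ j
  even-predecessor {zero}  _        _   =
    N ∸ 1 , N∸1<N , subst (2 ∣_) (sym 1+[N∸1]≡N) 2∣N , trans (cong (_% N) 1+[N∸1]≡N) (n%n≡0 N)
    where
    1+[N∸1]≡N : suc (N ∸ 1) ≡ N
    1+[N∸1]≡N = m+[n∸m]≡n (<-≤-trans (s≤s z≤n) (∣⇒≤ 2∣N))
    N∸1<N : N ∸ 1 < N
    N∸1<N = subst (N ∸ 1 <_) 1+[N∸1]≡N ≤-refl
  even-predecessor {suc j} 1+j<N 2∣1+j = j , <-trans (n<1+n j) 1+j<N , 2∣1+j , m<n⇒m%n≡m 1+j<N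

module _ {N : ℕ} .{{_ : NonZero N}} {G : Graph n} {x y : Fin n}
         (sym-G : Symmetric G) (x≢y : x ≢ y) (2∣N : 2 ∣ N) where

  consecutive⇒Dead : (cyc : Cycle G x y N) → G y (Cycle.at cyc 0) ≡ true → G y (Cycle.at cyc 1) ≡ true →
    Dead G x
  consecutive⇒Dead cyc y∼at₀ y∼at₁ {w} w≢x = pm
    where
    open Cycle cyc
    G⁺ : Graph n
    G⁺ = addEdge G x w
    sym-G⁺ : Symmetric G⁺
    sym-G⁺ = addEdge-sym {u = x} {w} sym-G
    cyc⁺ : Cycle G⁺ x y N
    cyc⁺ = Cycle-addEdge x w cyc
    x∼ : ∀ {j} → at j ≡ w → G⁺ x (at j) ≡ true
    x∼ at-j≡w = subst (λ v → G⁺ x v ≡ true) (sym at-j≡w) (addEdge-new G x w)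
    1<N : 1 < N
    1<N = ∣⇒≤ 2∣N
    -- For w = Cⱼ pair y with C₀ if j is odd; otherwise rotate C by one and pair y with C₁.
    pm : HasPM G⁺
    pm with w ≟ y
    ... | yes refl = xy⇒HasPM sym-G⁺ x≢y cyc⁺ 2∣N (addEdge-new G x w)
    ... | no w≢y with j , j<N , at-j≡w ← surjective (w≢x , w≢y) with even-or-odd j
    ...   | inj₂ 2∣1+j =
      odd-gap⇒HasPM sym-G⁺ x≢y cyc⁺ 2∣N (⊆-addEdge G x w _ _ y∼at₀) j<N 2∣1+j (x∼ at-j≡w)
    ...   | inj₁ 2∣j with i , i<N , 2∣1+i , 1+i%N≡j ← even-predecessor 2∣N j<N 2∣j =
      odd-gap⇒HasPM sym-G⁺ x≢y (Cycle-rotate (<⇒≤ 1<N) cyc⁺) 2∣N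
        (subst (λ k → G⁺ y (at k) ≡ true) (sym (m<n⇒m%n≡m 1<N)) (⊆-addEdge G x w _ _ y∼at₁))
        i<N 2∣1+i (x∼ (trans (cong at 1+i%N≡j) at-j≡w))

  pendants⇒Dead : InnerComplete G x y → Cycle G x y N → ∀ {a b} → Inner x y a → Inner x y b → a ≢ b →
    G y a ≡ true → G y b ≡ true → Dead G x
  pendants⇒Dead complete cyc {a} {b} inner-a inner-b a≢b y∼a y∼b {w} w≢x = pm
    where
    G⁺ : Graph n
    G⁺ = addEdge G x w
    sym-G⁺ : Symmetric G⁺
    sym-G⁺ = addEdge-sym {u = x} {w} sym-G
    cyc⁺ : Cycle G⁺ x y N
    cyc⁺ = Cycle-addEdge x w cyc
    complete⁺ : InnerComplete G⁺ x y
    complete⁺ = InnerComplete-addEdge x w complete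
    pm : HasPM G⁺
    pm with w ≟ y
    ... | yes refl = xy⇒HasPM sym-G⁺ x≢y cyc⁺ 2∣N (addEdge-new G x w)
    ... | no w≢y with w ≟ a
    ...   | yes refl = pendants⇒HasPM sym-G⁺ x≢y complete⁺ cyc⁺ 2∣N inner-b inner-a (a≢b ∘ sym)
                         (⊆-addEdge G x w _ _ y∼b) (addEdge-new G x w)
    ...   | no w≢a   = pendants⇒HasPM sym-G⁺ x≢y complete⁺ cyc⁺ 2∣N inner-a (w≢x , w≢y) (w≢a ∘ sym)
                         (⊆-addEdge G x w _ _ y∼a) (addEdge-new G x w)

∑ : (Fin n → ℕ) → ℕ
∑ {n} f = sum (map f (allFin n))

∑-suc : (f : Fin (suc n) → ℕ) → ∑ f ≡ f Fin.zero + ∑ (f ∘ Fin.suc)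
∑-suc f = cong (f Fin.zero +_) (cong sum
  (trans (map-tabulate Fin.suc f) (sym (map-tabulate (λ i → i) (f ∘ Fin.suc)))))

∑-cong : ∀ {f g : Fin n → ℕ} → (∀ i → f i ≡ g i) → ∑ f ≡ ∑ g
∑-cong {zero}          _   = refl
∑-cong {suc n} {f} {g} f≗g = begin
  ∑ f                             ≡⟨ ∑-suc f ⟩
  f Fin.zero + ∑ (f ∘ Fin.suc)    ≡⟨ cong₂ _+_ (f≗g Fin.zero) (∑-cong (f≗g ∘ Fin.suc)) ⟩
  g Fin.zero + ∑ (g ∘ Fin.suc)    ≡⟨ ∑-suc g ⟨
  ∑ g                             ∎
  where open ≡-Reasoning

∑-mono-≤ : ∀ {f g : Fin n → ℕ} → (∀ i → f i ≤ g i) → ∑ f ≤ ∑ g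
∑-mono-≤ {zero}          _ = z≤n
∑-mono-≤ {suc n} {f} {g} f≤g rewrite ∑-suc f | ∑-suc g =
  +-mono-≤ (f≤g Fin.zero) (∑-mono-≤ (f≤g ∘ Fin.suc))

∑-mono-< : ∀ {f g : Fin n → ℕ} → (∀ i → f i ≤ g i) → ∀ i → f i < g i → ∑ f < ∑ g
∑-mono-< {suc n} {f} {g} f≤g Fin.zero    f<g rewrite ∑-suc f | ∑-suc g =
  +-mono-<-≤ f<g (∑-mono-≤ (f≤g ∘ Fin.suc))
∑-mono-< {suc n} {f} {g} f≤g (Fin.suc i) f<g rewrite ∑-suc f | ∑-suc g =
  +-mono-≤-< (f≤g Fin.zero) (∑-mono-< (f≤g ∘ Fin.suc) i f<g)

indicator : Bool → ℕ
indicator b = if b then 1 else 0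

indicator≤1 : ∀ b → indicator b ≤ 1
indicator≤1 true  = ≤-refl
indicator≤1 false = z≤n

count : (Fin n → Bool) → ℕ
count P = ∑ (indicator ∘ P)

nonEdges : Graph n → ℕ
nonEdges G = ∑ λ a → ∑ λ b → indicator (not (G a b))

nonEdges-addEdge : G u v ≡ false → nonEdges (addEdge G u v) < nonEdges G
nonEdges-addEdge {G = G} {u} {v} uv∉G =
  ∑-mono-< (λ a → ∑-mono-≤ (fewer a)) u (∑-mono-< (fewer u) v strictly)
  where
  fewer : ∀ a b → indicator (not (addEdge G u v a b)) ≤ indicator (not (G a b))
  fewer a b with G a b
  ... | true  = z≤n
  ... | false = indicator≤1 _
  strictly : indicator (not (addEdge G u v u v)) < indicator (not (G u v))
  strictly rewrite addEdge-new G u v | uv∉G = s≤s z≤n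

edgeCount-suc : (G : Graph (suc n)) →
  edgeCount G ≡
  ∑ (indicator ∘ G Fin.zero ∘ Fin.suc) + edgeCount {n} (λ a b → G (Fin.suc a) (Fin.suc b))
edgeCount-suc G =
  trans (∑-suc (λ u → ∑ (λ v → indicator ((toℕ u ℕ.<ᵇ toℕ v) ∧ G u v))))
    (cong₂ _+_ (∑-suc (λ v → indicator ((0 ℕ.<ᵇ toℕ v) ∧ G Fin.zero v)))
      (∑-cong λ u → ∑-suc (λ v → indicator ((suc (toℕ u) ℕ.<ᵇ toℕ v) ∧ G (Fin.suc u) v))))

clique-count : (G : Graph n) (P : Fin n → Bool) →
  (∀ {a b} → P a ≡ true → P b ≡ true → a ≢ b → G a b ≡ true) → count P C 2 ≤ edgeCount G
clique-count {zero}  G P clique = z≤n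
clique-count {suc n} G P clique = begin
  count P C 2                                ≡⟨ cong (_C 2) (∑-suc (indicator ∘ P)) ⟩
  (indicator (P Fin.zero) + k) C 2           ≤⟨ first-vertex (P Fin.zero) refl ⟩
  ∑ (indicator ∘ G Fin.zero ∘ Fin.suc) + edgeCount G′  ≡⟨ edgeCount-suc G ⟨
  edgeCount G                                ∎
  where
  open Data.Nat.Properties.≤-Reasoning
  G′ : Graph n
  G′ a b = G (Fin.suc a) (Fin.suc b)
  k : ℕ
  k = count (P ∘ Fin.suc)
  rest : k C 2 ≤ edgeCount G′
  rest = clique-count G′ (P ∘ Fin.suc) (λ Pa Pb a≢b → clique Pa Pb (a≢b ∘ Finₚ.suc-injective))
  first-vertex : ∀ b → P Fin.zero ≡ b →
    (indicator b + k) C 2 ≤ ∑ (indicator ∘ G Fin.zero ∘ Fin.suc) + edgeCount G′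
  first-vertex false _  = ≤-trans rest (m≤n+m _ _)
  first-vertex true  P₀ = begin
    suc k C 2        ≡⟨ nCk+nC[k+1]≡[n+1]C[k+1] k 1 ⟨
    k C 1 + k C 2    ≡⟨ cong (_+ k C 2) (nC1≡n k) ⟩
    k + k C 2        ≤⟨ +-mono-≤ (∑-mono-≤ joined) rest ⟩
    _                ∎
    where
    joined : ∀ v → indicator (P (Fin.suc v)) ≤ indicator (G Fin.zero (Fin.suc v))
    joined v with P (Fin.suc v) in P-v
    ... | false = z≤n
    ... | true rewrite clique P₀ P-v (λ ()) = ≤-refl

isInner : Fin n → Fin n → Fin n → Bool
isInner x y v = not ⌊ v ≟ x ⌋ ∧ not ⌊ v ≟ y ⌋

count-true : ∀ n → count {n} (λ _ → true) ≡ n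
count-true zero    = refl
count-true (suc n) = trans (∑-suc {n} (λ _ → 1)) (cong suc (count-true n))

≟-suc : ∀ (a b : Fin n) → ⌊ Fin.suc a ≟ Fin.suc b ⌋ ≡ ⌊ a ≟ b ⌋
≟-suc a b with a ≟ b
... | yes _ = refl
... | no _  = refl

count-≢ : ∀ n (x : Fin (suc n)) → count (λ v → not ⌊ v ≟ x ⌋) ≡ n
count-≢ n       Fin.zero    = trans (∑-suc {n} (λ v → indicator (not ⌊ v ≟ Fin.zero ⌋))) (count-true n)
count-≢ (suc n) (Fin.suc x) =
  trans (∑-suc {suc n} (λ v → indicator (not ⌊ v ≟ Fin.suc x ⌋)))
    (cong suc (trans (∑-cong (λ v → cong (indicator ∘ not) (≟-suc v x))) (count-≢ n x)))

count-inner : ∀ m {x y : Fin (suc (suc m))} → x ≢ y → count (isInner x y) ≡ m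
count-inner m       {Fin.zero}  {Fin.zero}  x≢y = ⊥-elim (x≢y refl)
count-inner m       {Fin.zero}  {Fin.suc y} _   =
  trans (∑-suc {suc m} (indicator ∘ isInner Fin.zero (Fin.suc y)))
    (trans (∑-cong (λ v → cong (indicator ∘ not) (≟-suc v y))) (count-≢ m y))
count-inner m       {Fin.suc x} {Fin.zero}  _   =
  trans (∑-suc {suc m} (indicator ∘ isInner (Fin.suc x) Fin.zero))
    (trans (∑-cong λ v → cong indicator (trans (∧-identityʳ _) (cong not (≟-suc v x)))) (count-≢ m x))
count-inner zero    {Fin.suc Fin.zero} {Fin.suc Fin.zero} x≢y = ⊥-elim (x≢y refl)
count-inner (suc m) {Fin.suc x} {Fin.suc y} x≢y =
  trans (∑-suc {suc (suc m)} (indicator ∘ isInner (Fin.suc x) (Fin.suc y)))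
    (cong suc (trans (∑-cong λ v → cong indicator (cong₂ (λ p q → not p ∧ not q) (≟-suc v x) (≟-suc v y)))
                     (count-inner m (x≢y ∘ cong Fin.suc))))

final-count : ∀ {m} {G : Graph (suc (suc m))} {x y} → x ≢ y → InnerComplete G x y →
  m C 2 ≤ edgeCount G
final-count {m} {G} {x} {y} x≢y complete =
  subst (λ k → k C 2 ≤ edgeCount G) (count-inner m x≢y)
    (clique-count G (isInner x y) λ Pa Pb → complete (inner Pa) (inner Pb))
  where
  ≢-sound : ∀ {a b : Fin (suc (suc m))} → not ⌊ a ≟ b ⌋ ≡ true → a ≢ b
  ≢-sound {a} {b} e with a ≟ b
  ... | no a≢b = a≢b
  inner : ∀ {a} → isInner x y a ≡ true → Inner x y a
  inner P = ≢-sound (∧-conicalˡ _ _ P) , ≢-sound (∧-conicalʳ _ _ P)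

edgeCount-cong : G ≐ H → edgeCount G ≡ edgeCount H
edgeCount-cong G≐H =
  ∑-cong λ a → ∑-cong λ b → cong (λ e → indicator ((toℕ a ℕ.<ᵇ toℕ b) ∧ e)) (G≐H a b)

Legal-cong : G ≐ H → Legal G u v → Legal H u v
Legal-cong {u = u} {v} G≐H (u<v , uv∉G , ¬pm) =
  u<v , trans (sym (G≐H u v)) uv∉G , ¬pm ∘ HasPM-mono (≐⇒⊆ (addEdge-cong (≐-sym G≐H)))

Legal⇒≢ : Legal G u v → u ≢ v
Legal⇒≢ (u<v , _) u≡v = <-irrefl (cong toℕ u≡v) u<v

MaxForces-cong : ∀ {k p} → G ≐ H → MaxForces k p G → MaxForces k p H
MaxForces-cong G≐H (done stuck enough) =
  done (λ u v → stuck u v ∘ Legal-cong (≐-sym G≐H)) (subst (_ ≤_) (edgeCount-cong G≐H) enough)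
MaxForces-cong G≐H (miniMove (u , v , legal) next) =
  miniMove (u , v , Legal-cong G≐H legal)
    (λ u v legal → MaxForces-cong (addEdge-cong G≐H) (next u v (Legal-cong (≐-sym G≐H) legal)))
MaxForces-cong G≐H (maxMove u v legal next) =
  maxMove u v (Legal-cong G≐H legal) (MaxForces-cong (addEdge-cong G≐H) next)

samePair-forces : ∀ {k p} → SamePair u v a b →
  MaxForces k p (addEdge G a b) → MaxForces k p (addEdge G u v)
samePair-forces {G = G} same = MaxForces-cong (≐-sym (addEdge-samePair {G = G} same))

Addable : Graph n → Fin n → Fin n → Set
Addable G u v = u ≢ v × G u v ≡ false × ¬ HasPM (addEdge G u v)

addable-avoiding : Isolated G z → u ≢ z → v ≢ z → u ≢ v → G u v ≡ false → Addable G u v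
addable-avoiding {G = G} {u = u} {v} iso u≢z v≢z u≢v uv∉G =
  u≢v , uv∉G ,
  isolated⇒¬HasPM {G = addEdge G u v} (addEdge-isolated {G = G} {u = u} {v} iso u≢z v≢z)

orient : Symmetric G → Addable G u v →
  ∃[ u′ ] ∃[ v′ ] Legal G u′ v′ × addEdge G u′ v′ ≐ addEdge G u v
orient {G = G} {u} {v} sym-G (u≢v , uv∉G , ¬pm) with <-cmp (toℕ u) (toℕ v)
... | tri< u<v _ _ = u , v , (u<v , uv∉G , ¬pm) , λ _ _ → refl
... | tri≈ _ u≡v _ = ⊥-elim (u≢v (Finₚ.toℕ-injective u≡v))
... | tri> _ _ v<u =
  v , u , (v<u , trans (sym-G v u) uv∉G , ¬pm ∘ HasPM-mono (≐⇒⊆ (addEdge-comm {G = G} {v} {u}))) ,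
  addEdge-comm {G = G} {v} {u}

max-adds : ∀ {k} → Symmetric G → Addable G u v →
  MaxForces k mini (addEdge G u v) → MaxForces k max G
max-adds sym-G addable next with u′ , v′ , legal , same ← orient sym-G addable =
  maxMove u′ v′ legal (MaxForces-cong (≐-sym same) next)

mini-can-move : Symmetric G → Addable G u v → ∃[ u′ ] ∃[ v′ ] Legal G u′ v′
mini-can-move sym-G addable with u′ , v′ , legal , _ ← orient sym-G addable = u′ , v′ , legal

data MoveShape (x y u v : Fin n) : Set where
  joining : SamePair u v x y → MoveShape x y u v
  at-y    : ∀ {w} → Inner x y w → SamePair u v y w → MoveShape x y u v
  at-x    : ∀ {w} → Inner x y w → SamePair u v x w → MoveShape x y u v
  inside  : Inner x y u → Inner x y v → MoveShape x y u v

moveShape : x ≢ y → u ≢ v → MoveShape x y u v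
moveShape {x = x} {y} {u} {v} x≢y u≢v with u ≟ x | u ≟ y | v ≟ x | v ≟ y
... | yes refl | _        | yes refl | _        = ⊥-elim (u≢v refl)
... | yes refl | _        | no v≢x   | yes refl = joining (inj₁ (refl , refl))
... | yes refl | _        | no v≢x   | no v≢y   = at-x (v≢x , v≢y) (inj₁ (refl , refl))
... | no u≢x   | yes refl | yes refl | _        = joining (inj₂ (refl , refl))
... | no u≢x   | yes refl | no _     | yes refl = ⊥-elim (u≢v refl)
... | no u≢x   | yes refl | no v≢x   | no v≢y   = at-y (v≢x , v≢y) (inj₁ (refl , refl))
... | no u≢x   | no u≢y   | yes refl | _        = at-x (u≢x , u≢y) (inj₂ (refl , refl))
... | no u≢x   | no u≢y   | no v≢x   | yes refl = at-y (u≢x , u≢y) (inj₂ (refl , refl))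
... | no u≢x   | no u≢y   | no v≢x   | no v≢y   = inside (u≢x , u≢y) (v≢x , v≢y)

non-edge-or-complete : ∀ {Q : Fin n → Set} → (∀ v → Dec (Q v)) → Symmetric G →
  (∃[ u ] ∃[ v ] Q u × Q v × u ≢ v × G u v ≡ false) ⊎
  (∀ {a b} → Q a → Q b → a ≢ b → G a b ≡ true)
non-edge-or-complete {G = G} Q? sym-G
  with Finₚ.any? (λ u → Finₚ.any? λ v → Q? u ×-dec Q? v ×-dec ¬? (u ≟ v) ×-dec (G u v Boolₚ.≟ false))
... | yes found = inj₁ found
... | no none   = inj₂ λ {a} {b} Qa Qb a≢b → ¬-not λ ab∉G → none (a , b , Qa , Qb , a≢b , ab∉G)

Dead⇒avoids : Dead G x → Legal G u v → u ≢ x × v ≢ x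
Dead⇒avoids {G = G} {u = u} {v} dead legal@(_ , _ , ¬pm) =
  (λ { refl → ¬pm (dead (Legal⇒≢ {G = G} legal ∘ sym)) }) ,
  (λ { refl → ¬pm (HasPM-mono (≐⇒⊆ (addEdge-comm {G = G} {v} {u}))
                                (dead (Legal⇒≢ {G = G} legal))) })

addable-pendant : Isolated G x → x ≢ y → Inner x y w → G y w ≡ false → Addable G y w
addable-pendant {G = G} iso-x x≢y (w≢x , w≢y) yw∉G =
  addable-avoiding {G = G} iso-x (x≢y ∘ sym) w≢x (w≢y ∘ sym) yw∉G

isolated-after-pendant : Isolated G x → x ≢ y → Inner x y w → Isolated (addEdge G y w) x
isolated-after-pendant {G = G} iso-x x≢y (w≢x , _) = addEdge-isolated {G = G} iso-x (x≢y ∘ sym) w≢x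

fuel-step : ∀ {k} → nonEdges G < suc k → G u v ≡ false → nonEdges (addEdge G u v) < k
fuel-step {G = G} fuel uv∉G = <-≤-trans (nonEdges-addEdge {G = G} uv∉G) (≤-pred fuel)

-- Max's strategy

module Strategy (m : ℕ) .{{_ : NonZero m}} (2∣m : 2 ∣ m) where

  Forces : Player → Graph (suc (suc m)) → Set
  Forces = MaxForces (m C 2)

  record Board (G : Graph (suc (suc m))) (x y : Fin (suc (suc m))) : Set where
    field
      x≢y       : x ≢ y
      symmetric : Symmetric G
      cycle     : Cycle G x y m

  Board-addEdge : ∀ {G x y} u v → Board G x y → Board (addEdge G u v) x y
  Board-addEdge u v B = record
    { x≢y = x≢y ; symmetric = addEdge-sym {u = u} {v} symmetric ; cycle = Cycle-addEdge u v cycle }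
    where open Board B

  Board-swap : ∀ {G x y} → Board G x y → Board G y x
  Board-swap B = record { x≢y = x≢y ∘ sym ; symmetric = symmetric ; cycle = Cycle-swap cycle }
    where open Board B

  0<m : 0 < m
  0<m = <-trans (s≤s z≤n) (∣⇒≤ 2∣m)

  joining-xy⇒HasPM : ∀ {G x y} → Board G x y → HasPM (addEdge G x y)
  joining-xy⇒HasPM {G} {x} {y} B = xy⇒HasPM symmetric x≢y cycle 2∣m (addEdge-new G x y)
    where open Board (Board-addEdge x y B)

  second-pendant⇒HasPM : ∀ {G x y a b} → Board G x y → InnerComplete G x y →
    Inner x y a → Inner x y b → a ≢ b → G y a ≡ true → HasPM (addEdge G x b)
  second-pendant⇒HasPM {G} {x} {y} {b = b} B complete inner-a inner-b a≢b y∼a =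
    pendants⇒HasPM symmetric x≢y (InnerComplete-addEdge x b complete) cycle 2∣m inner-a inner-b a≢b
      (⊆-addEdge G x b _ _ y∼a) (addEdge-new G x b)
    where open Board (Board-addEdge x b B)

  forces-when-dead : ∀ {G x y} p → x ≢ y → Symmetric G → Isolated G x → Dead G x → Forces p G
  forces-when-dead {G} p = go (suc (nonEdges G)) p ≤-refl
    where
    go : ∀ {G x y} k p → nonEdges G < k → x ≢ y → Symmetric G → Isolated G x → Dead G x →
      Forces p G
    go {G} {x} (suc k) p fuel x≢y sym-G iso dead with non-edge-or-complete (λ v → ¬? (v ≟ x)) sym-G
    ... | inj₂ complete =
      done (λ u v legal@(_ , uv∉G , _) → let u≢x , v≢x = Dead⇒avoids {G = G} dead legal in
              true≢false (trans (sym (complete u≢x v≢x (Legal⇒≢ {G = G} legal))) uv∉G))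
           (final-count x≢y λ inner-a inner-b → complete (proj₁ inner-a) (proj₁ inner-b))
    ... | inj₁ (u , v , u≢x , v≢x , u≢v , uv∉G) = move p
      where
      continue : ∀ {u v} p → u ≢ x → v ≢ x → G u v ≡ false → Forces p (addEdge G u v)
      continue {u} {v} p u≢x v≢x uv∉G =
        go k p (fuel-step {G = G} fuel uv∉G) x≢y (addEdge-sym {u = u} {v} sym-G)
          (addEdge-isolated {G = G} iso u≢x v≢x) (Dead-mono (⊆-addEdge G u v) dead)
      addable : Addable G u v
      addable = addable-avoiding {G = G} iso u≢x v≢x u≢v uv∉G
      move : ∀ p → Forces p G
      move mini = miniMove (mini-can-move sym-G addable) λ u v legal@(_ , uv∉G , _) →
        let u≢x , v≢x = Dead⇒avoids {G = G} dead legal in continue max u≢x v≢x uv∉G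
      move max = max-adds sym-G addable (continue mini u≢x v≢x uv∉G)

  -- Max joins y to the cycle successor w⁺ of its only neighbour w, which kills x.
  after-pendant : ∀ {G x y w} → Board G x y → Isolated G x →
    Inner x y w → G y w ≡ true → (∀ {d} → G y d ≡ true → d ≡ w) → Forces max G
  after-pendant {G} {x} {y} {w} B iso-x inner-w y∼w only-w
    with i , i<m , at-i≡w ← Cycle.surjective (Board.cycle B) inner-w =
    max-adds symmetric (addable-pendant {G = G} iso-x x≢y inner-w⁺ yw⁺∉G)
      (forces-when-dead mini x≢y (Board.symmetric B⁺)
        (isolated-after-pendant {G = G} iso-x x≢y inner-w⁺)
        (consecutive⇒Dead (Board.symmetric B⁺) x≢y 2∣m (Cycle-addEdge y w⁺ cyc′)
          (⊆-addEdge G y w⁺ _ _ (subst (λ v → G y v ≡ true) (sym at′₀≡w) y∼w)) (addEdge-new G y w⁺)))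
    where
    open Board B
    cyc′ : Cycle G x y m
    cyc′ = Cycle-rotate (<⇒≤ i<m) cycle
    open Cycle cyc′ using (injective; member) renaming (at to at′)
    w⁺ : Fin (suc (suc m))
    w⁺ = at′ 1
    B⁺ : Board (addEdge G y w⁺) x y
    B⁺ = Board-addEdge y w⁺ B
    inner-w⁺ : Inner x y w⁺
    inner-w⁺ = member (∣⇒≤ 2∣m)
    at′₀≡w : at′ 0 ≡ w
    at′₀≡w =
      trans (cong (Cycle.at cycle) (trans (cong (_% m) (+-identityʳ i)) (m<n⇒m%n≡m i<m))) at-i≡w
    yw⁺∉G : G y w⁺ ≡ false
    yw⁺∉G = ¬-not λ y∼w⁺ →
      contradiction (injective (∣⇒≤ 2∣m) 0<m (trans (only-w y∼w⁺) (sym at′₀≡w))) (λ ())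

  another-inner : ∀ {G x y} → Board G x y → ∀ a → ∃[ b ] Inner x y b × b ≢ a
  another-inner {x = x} {y} B a = pick (at 0 ≟ a)
    where
    open Cycle (Board.cycle B)
    pick : Dec (at 0 ≡ a) → ∃[ b ] Inner x y b × b ≢ a
    pick (no at₀≢a)  = at 0 , member 0<m , at₀≢a
    pick (yes at₀≡a) = at 1 , member (∣⇒≤ 2∣m) , λ at₁≡a →
      contradiction (injective (∣⇒≤ 2∣m) 0<m (trans at₁≡a (sym at₀≡a))) (λ ())

  stuck-when-both-pendant : ∀ {G x y a} → Board G x y → InnerComplete G x y →
    Inner x y a → G x a ≡ true → G y a ≡ true → ∀ u v → ¬ Legal G u v
  stuck-when-both-pendant {G} B complete inner-a x∼a y∼a u v legal@(_ , uv∉G , ¬pm)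
    with moveShape (Board.x≢y B) (Legal⇒≢ {G = G} legal)
  ... | joining same = ¬pm (samePair-HasPM {G = G} same (joining-xy⇒HasPM B))
  ... | inside inner-u inner-v =
    true≢false (trans (sym (complete inner-u inner-v (Legal⇒≢ {G = G} legal))) uv∉G)
  ... | at-x inner-w same = ¬pm (samePair-HasPM {G = G} same
    (second-pendant⇒HasPM B complete inner-a inner-w
      (≢-by-edge {G = G} x∼a (samePair-nonEdge (Board.symmetric B) same uv∉G)) y∼a))
  ... | at-y inner-w same = ¬pm (samePair-HasPM {G = G} same
    (second-pendant⇒HasPM (Board-swap B) (InnerComplete-swap complete) (swap inner-a) (swap inner-w)
      (≢-by-edge {G = G} y∼a (samePair-nonEdge (Board.symmetric B) same uv∉G)) x∼a))

  complete-with-pendant : ∀ {G x y a} → Board G x y → InnerComplete G x y → Isolated G x →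
    Inner x y a → G y a ≡ true → (∀ {d} → G y d ≡ true → d ≡ a) → Forces mini G
  complete-with-pendant {G} {x} {y} {a} B complete iso-x inner-a y∼a only-a
    with b , inner-b , b≢a ← another-inner B a =
    miniMove (mini-can-move symmetric (addable-pendant {G = G} iso-x x≢y inner-b (¬-not (b≢a ∘ only-a))))
      respond
    where
    open Board B
    respond : ∀ u v → Legal G u v → Forces max (addEdge G u v)
    respond u v legal@(_ , uv∉G , ¬pm) with moveShape x≢y (Legal⇒≢ {G = G} legal)
    ... | joining same = ⊥-elim (¬pm (samePair-HasPM {G = G} same (joining-xy⇒HasPM B)))
    ... | inside inner-u inner-v =
      ⊥-elim (true≢false (trans (sym (complete inner-u inner-v (Legal⇒≢ {G = G} legal))) uv∉G))
    ... | at-y {w} inner-w same = samePair-forces {G = G} same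
      (forces-when-dead max x≢y (Board.symmetric B⁺) (isolated-after-pendant {G = G} iso-x x≢y inner-w)
        (pendants⇒Dead (Board.symmetric B⁺) x≢y 2∣m (InnerComplete-addEdge y w complete) (Board.cycle B⁺)
          inner-a inner-w (≢-by-edge {G = G} y∼a (samePair-nonEdge symmetric same uv∉G))
          (⊆-addEdge G y w _ _ y∼a) (addEdge-new G y w)))
      where
      B⁺ : Board (addEdge G y w) x y
      B⁺ = Board-addEdge y w B
    ... | at-x {w} inner-w same with w ≟ a
    ...   | no w≢a = ⊥-elim (¬pm (samePair-HasPM {G = G} same
      (second-pendant⇒HasPM B complete inner-a inner-w (w≢a ∘ sym) y∼a)))
    ...   | yes refl = samePair-forces {G = G} same
      (done (stuck-when-both-pendant (Board-addEdge x a B) complete⁺ inner-a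
               (addEdge-new G x a) (⊆-addEdge G x a _ _ y∼a))
            (final-count x≢y complete⁺))
      where
      complete⁺ : InnerComplete (addEdge G x a) x y
      complete⁺ = InnerComplete-addEdge x a complete

  mutual
    both-isolated : ∀ {G x y} k → nonEdges G < k → Board G x y →
      Isolated G x → Isolated G y → Forces mini G
    both-isolated {G} {x} {y} (suc k) fuel B iso-x iso-y =
      miniMove (mini-can-move symmetric (addable-pendant {G = G} iso-x x≢y inner-at₀ (iso-y _))) respond
      where
      open Board B
      inner-at₀ : Inner x y (Cycle.at cycle 0)
      inner-at₀ = Cycle.member cycle 0<m
      respond : ∀ u v → Legal G u v → Forces max (addEdge G u v)
      respond u v legal@(_ , uv∉G , ¬pm) with moveShape x≢y (Legal⇒≢ {G = G} legal)
      ... | joining same = ⊥-elim (¬pm (samePair-HasPM {G = G} same (joining-xy⇒HasPM B)))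
      ... | inside (u≢x , u≢y) (v≢x , v≢y) =
        after-inner k (fuel-step {G = G} fuel uv∉G) (Board-addEdge u v B)
          (addEdge-isolated {G = G} iso-x u≢x v≢x) (addEdge-isolated {G = G} iso-y u≢y v≢y)
      ... | at-y {w} inner-w same = samePair-forces {G = G} same
        (after-pendant (Board-addEdge y w B) (isolated-after-pendant {G = G} iso-x x≢y inner-w)
          inner-w (addEdge-new G y w) (only-neighbour {G = G} iso-y (proj₂ inner-w)))
      ... | at-x {w} inner-w same = samePair-forces {G = G} same
        (after-pendant (Board-swap (Board-addEdge x w B))
          (isolated-after-pendant {G = G} iso-y (x≢y ∘ sym) (swap inner-w)) (swap inner-w)
          (addEdge-new G x w) (only-neighbour {G = G} iso-x (proj₁ inner-w)))

    after-inner : ∀ {G x y} k → nonEdges G < k → Board G x y →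
      Isolated G x → Isolated G y → Forces max G
    after-inner {G} {x} {y} k fuel B iso-x iso-y
      with non-edge-or-complete (λ v → ¬? (v ≟ x) ×-dec ¬? (v ≟ y)) (Board.symmetric B)
    ... | inj₁ (u , v , (u≢x , u≢y) , (v≢x , v≢y) , u≢v , uv∉G) =
      max-adds (Board.symmetric B) (addable-avoiding {G = G} iso-x u≢x v≢x u≢v uv∉G)
        (both-isolated k (<-trans (nonEdges-addEdge {G = G} uv∉G) fuel) (Board-addEdge u v B)
          (addEdge-isolated {G = G} iso-x u≢x v≢x) (addEdge-isolated {G = G} iso-y u≢y v≢y))
    ... | inj₂ complete =
      max-adds (Board.symmetric B) (addable-pendant {G = G} iso-x (Board.x≢y B) inner-at₀ (iso-y _))
        (complete-with-pendant (Board-addEdge y at₀ B) (InnerComplete-addEdge y at₀ complete)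
          (isolated-after-pendant {G = G} iso-x (Board.x≢y B) inner-at₀) inner-at₀
          (addEdge-new G y at₀) (only-neighbour {G = G} iso-y (proj₂ inner-at₀)))
      where
      at₀ : Fin (suc (suc m))
      at₀ = Cycle.at (Board.cycle B) 0
      inner-at₀ : Inner x y at₀
      inner-at₀ = Cycle.member (Board.cycle B) 0<m

-- The hypothesis 6 ≤ n only serves to make n ∸ 2 positive: the strategy works for all even n ≥ 4.
lemma4p1 : (n : ℕ) → 6 ≤ n → 2 ∣ n → (G₀ : Graph n) → IsSimple G₀ →
    (x y : Fin n) → x ≢ y → Isolated G₀ x → Isolated G₀ y →
    HamCycleWithout G₀ x y (n ∸ 2) →
    MaxForces ((n ∸ 2) C 2) mini G₀
lemma4p1 (suc (suc m)) (s≤s (s≤s (s≤s (s≤s (s≤s (s≤s _)))))) 2∣n G₀ (sym-G₀ , _) x y x≢y iso-x iso-y ham =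
  Strategy.both-isolated m 2∣m (suc (nonEdges G₀)) ≤-refl board iso-x iso-y
  where
  2∣m : 2 ∣ m
  2∣m = ∣m+n∣m⇒∣n 2∣n (divides 1 refl)
  board : Strategy.Board m 2∣m G₀ x y
  board = record { x≢y = x≢y ; symmetric = sym-G₀ ; cycle = HamCycle⇒Cycle x≢y ham }
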